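{- For all integers $1\le\ell<s$ and $m\ge1$, the degeneracy of $P_m^{(s,\ell)}$ is $1$, and for $m\ge\lfloor (s+1)/(s-\ell)\rfloor$ the degeneracy of $C_m^{(s,\ell)}$ is $\lfloor\frac{s}{s-\ell}\rfloor$.
   Context: The degeneracy of a hypergraph $H$ is $d(H)=\max\{\delta(H'):H'\subseteq H\}$, where $\delta$ denotes minimum vertex degree. The $\ell$-tight $s$-uniform cycle $C_m^{(s,\ell)}$ has $(s-\ell)m$ vertices in cyclic order and $m$ edges, each a segment of $s$ consecutive vertices, evenly spread so that consecutive edges share exactly $\ell$ vertices. The $\ell$-tight $s$-path $P_m^{(s,\ell)}$ has $(s-\ell)m+\ell$ vertices in linear order and $m$ edges, each a segment of $s$ consecutive vertices, consecutive edges sharing exactly $\ell$ vertices. -}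

module Defs where

open import Data.Nat using (ℕ; zero; suc; _+_; _*_; _∸_; _≤_; _<ᵇ_; _≤ᵇ_; _/_; _%_)
open import Data.Bool using (Bool; true; false; _∧_)
open import Data.Fin using (Fin; toℕ)
open import Data.Fin.Subset using (Subset; _∈_; _⊆_; _∩_; ∣_∣)
open import Data.Vec using (tabulate; lookup)
open import Data.Product using (Σ; ∃; _×_)
open import Relation.Binary.PropositionalEquality using (_≡_)

record Hypergraph : Set where
  field
    nV    : ℕ
    nE    : ℕ
    edge  : Fin nE → Subset nV
open Hypergraph public

-- Sub-hypergraph H' ⊆ H: a vertex set U and an edge set F (a subset of the
-- edges of H) such that every edge of F lies inside U.
IsSub : (H : Hypergraph) → Subset (nV H) → Subset (nE H) → Set
IsSub H U F = ∀ e → e ∈ F → edge H e ⊆ U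

deg : (H : Hypergraph) → Subset (nE H) → Fin (nV H) → ℕ
deg H F v = ∣ F ∩ tabulate (λ e → lookup (edge H e) v) ∣

-- δ(H') = k  for the sub-hypergraph (U , F) (U necessarily nonempty)
MinDeg : (H : Hypergraph) → Subset (nV H) → Subset (nE H) → ℕ → Set
MinDeg H U F k =
  (∀ v → v ∈ U → k ≤ deg H F v) × (∃ λ v → v ∈ U × deg H F v ≡ k)

Degeneracy : Hypergraph → ℕ → Set
Degeneracy H d =
  (Σ (Subset (nV H)) λ U → Σ (Subset (nE H)) λ F → IsSub H U F × MinDeg H U F d)
  × (∀ U F k → IsSub H U F → MinDeg H U F k → k ≤ d)

-- floor division, with the (irrelevant) convention a ÷ 0 = 0
_÷_ : ℕ → ℕ → ℕ
a ÷ zero  = zero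
a ÷ suc k = a / suc k

-- remainder, with the (irrelevant) convention a mod 0 = a
_mod_ : ℕ → ℕ → ℕ
a mod zero  = a
a mod suc k = a % suc k

-- ℓ-tight s-uniform path P_m^(s,ℓ): vertices 0 .. (s-ℓ)m+ℓ-1,
-- edge i (i < m) = { i(s-ℓ), ..., i(s-ℓ)+s-1 }.
Path : ℕ → ℕ → ℕ → Hypergraph
Path s ℓ m = record
  { nV = (s ∸ ℓ) * m + ℓ
  ; nE = m
  ; edge = λ i → tabulate λ v →
      (toℕ i * (s ∸ ℓ) ≤ᵇ toℕ v) ∧ (toℕ v <ᵇ toℕ i * (s ∸ ℓ) + s)
  }

-- ℓ-tight s-uniform cycle C_m^(s,ℓ): vertices 0 .. N-1 with N = (s-ℓ)m in
-- cyclic order, edge i (i < m) = { i(s-ℓ)+j mod N : j < s }, i.e. v is in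
-- edge i iff its forward cyclic distance from i(s-ℓ) is < s.
Cycle : ℕ → ℕ → ℕ → Hypergraph
Cycle s ℓ m = record
  { nV = (s ∸ ℓ) * m
  ; nE = m
  ; edge = λ i → tabulate λ v →
      ((toℕ v + (s ∸ ℓ) * m ∸ toℕ i * (s ∸ ℓ)) mod ((s ∸ ℓ) * m)) <ᵇ s
  }

-- Write d = s − ℓ. In the path every vertex lies in an edge, while in any nonempty
-- set of edges the first vertex of the leftmost edge lies in no other edge of the
-- set; hence the degeneracy is 1.
-- In the cycle write a vertex as a d + r with r < d. After the substitution
-- j ↦ a − j (mod m) on edge indices, the edges through it are the t < m with
-- t d + r < s. Since m ≥ ⌊s/d⌋ this count is at least ⌊s/d⌋, with equality for
-- r = d − 1; and every edge contains a vertex with r = d − 1, whose degree can only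
-- drop in a sub-hypergraph.
module Submission where

open import Defs
open import Data.Bool using (Bool; true; false; T; if_then_else_)
open import Data.Bool.Properties using (T-≡; T-∧)
open import Data.Empty using (⊥-elim)
open import Data.Sum using (inj₁; inj₂)
open import Data.Fin as Fin using (Fin; toℕ; fromℕ<)
open import Data.Fin.Properties using (toℕ-fromℕ<; toℕ-injective; toℕ<n)
open import Data.Fin.Subset using (Subset; _∈_; _⊆_; _∩_; ∣_∣; ⊤; ⊥; ⁅_⁆; inside; outside; Nonempty; Empty)
open import Data.Fin.Subset.Properties
  using (∈⊤; ⊆⊤; x∈⁅x⁆; ∣⁅x⁆∣≡1; ∣⊥∣≡0; Empty-unique; drop-there; x∈⁅y⁆⇒x≡y; nonempty?; p⊆q⇒∣p∣≤∣q∣;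
         x∈p∩q⁺; x∈p∩q⁻; ∣p∩q∣≤∣p∣; ∩-identityˡ)
open import Data.Nat using (ℕ; zero; suc; _+_; _*_; _∸_; pred; _⊓_; _≤_; _<_; _≥_; _<ᵇ_; _/_; _%_;
                            z≤n; s≤s; z<s; s<s; NonZero; >-nonZero; >-nonZero⁻¹)
open import Data.Nat.Properties
open import Data.Nat.DivMod
  using (m≡m%n+[m/n]*n; m/n*n≤m; m*n/n≡m; /-monoˡ-≤; m<n*o⇒m/o<n; m%n<n; m<n⇒m%n≡m;
         [m+n]%n≡m%n; [m+kn]%n≡m%n; %-congʳ; m%n*o≡m*o%[n*o]; [m*n+o]%[p*n]≡[m*n]%[p*n]+o)
open import Data.Product using (_×_; _,_; proj₁; ∃; ∃₂)
open import Data.Vec using (tabulate; lookup; _∷_; here; there)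
open import Data.Vec.Properties using (lookup∘tabulate; tabulate-cong; []=⇒lookup; lookup⇒[]=)
open import Function using (_∘_; _⇔_; mk⇔; Equivalence)
open import Function.Properties.Equivalence using () renaming (trans to ⇔-trans; sym to ⇔-sym)
open import Relation.Nullary using (yes; no)
open import Relation.Binary.PropositionalEquality

open Equivalence using (to; from)

mod≡% : ∀ a n .{{_ : NonZero n}} → a mod n ≡ a % n
mod≡% a (suc n) = refl

÷≡/ : ∀ a n .{{_ : NonZero n}} → a ÷ n ≡ a / n
÷≡/ a (suc n) = refl

m*n≤o⇔m≤o/n : ∀ {m o} n .{{_ : NonZero n}} → m * n ≤ o ⇔ m ≤ o / n
m*n≤o⇔m≤o/n {m} {o} n = mk⇔
  (λ m*n≤o → subst (_≤ o / n) (m*n/n≡m m n) (/-monoˡ-≤ n m*n≤o))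
  (λ m≤o/n → ≤-trans (*-monoˡ-≤ n m≤o/n) (m/n*n≤m o n))

suc[m*n+pred[n]]≡suc[m]*n : ∀ m n .{{_ : NonZero n}} → suc (m * n + pred n) ≡ suc m * n
suc[m*n+pred[n]]≡suc[m]*n m (suc k) = cong suc (+-comm (m * suc k) k)

m*n+pred[n]<o⇔m<o/n : ∀ {m o} n .{{_ : NonZero n}} → m * n + pred n < o ⇔ m < o / n
m*n+pred[n]<o⇔m<o/n {m} {o} n =
  ⇔-trans (mk⇔ (subst (_≤ o) eq) (subst (_≤ o) (sym eq))) (m*n≤o⇔m≤o/n n)
  where
  eq : suc (m * n + pred n) ≡ suc m * n
  eq = suc[m*n+pred[n]]≡suc[m]*n m n

[m*n+o]%[n*p]≡[m%p]*n+o : ∀ m {n o} p .{{_ : NonZero n}} .{{_ : NonZero p}} .{{_ : NonZero (n * p)}} →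
                          o < n → (m * n + o) % (n * p) ≡ (m % p) * n + o
[m*n+o]%[n*p]≡[m%p]*n+o m {n} {o} p o<n = begin
  (m * n + o) % (n * p)    ≡⟨ %-congʳ (*-comm n p) ⟩
  (m * n + o) % (p * n)    ≡⟨ [m*n+o]%[p*n]≡[m*n]%[p*n]+o m p o<n ⟩
  (m * n) % (p * n) + o    ≡⟨ cong (_+ o) (m%n*o≡m*o%[n*o] m p n) ⟨
  (m % p) * n + o          ∎
  where
  open ≡-Reasoning
  instance
    p*n-nonZero : NonZero (p * n)
    p*n-nonZero = m*n≢0 p n

count : (ℕ → Bool) → ℕ → ℕ
count g zero    = zero
count g (suc n) = if g 0 then suc (count (g ∘ suc) n) else count (g ∘ suc) n

count-cong : ∀ {g h} n → (∀ {j} → j < n → g j ≡ h j) → count g n ≡ count h n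
count-cong zero    _   = refl
count-cong (suc n) g≗h =
  cong₂ (λ b c → if b then suc c else c) (g≗h z<s) (count-cong n (g≗h ∘ s<s))

count-mono : ∀ {g h} n → (∀ {j} → j < n → T (g j) → T (h j)) → count g n ≤ count h n
count-mono                 zero    _   = z≤n
count-mono {g} {h} (suc n) g⇒h with g 0 | h 0 | g⇒h {0} z<s
... | true  | true  | _   = s≤s (count-mono n (g⇒h ∘ s<s))
... | true  | false | g₀⇒ = ⊥-elim (g₀⇒ _)
... | false | true  | _   = m≤n⇒m≤1+n (count-mono n (g⇒h ∘ s<s))
... | false | false | _   = count-mono n (g⇒h ∘ s<s)

count-+ : ∀ g m n → count g (m + n) ≡ count g m + count (λ j → g (m + j)) n
count-+ g zero    n = refl
count-+ g (suc m) n with g 0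
... | true  = cong suc (count-+ (g ∘ suc) m n)
... | false = count-+ (g ∘ suc) m n

count-snoc : ∀ g n → count g (suc n) ≡ (if g n then suc (count g n) else count g n)
count-snoc g zero    = refl
count-snoc g (suc n) rewrite count-snoc (g ∘ suc) n with g 0 | g (suc n)
... | true  | true  = refl
... | true  | false = refl
... | false | true  = refl
... | false | false = refl

count-reverse : ∀ g n → count (λ j → g (n ∸ suc j)) n ≡ count g n
count-reverse g zero    = refl
count-reverse g (suc n) =
  trans (cong (λ c → if g n then suc c else c) (count-reverse g n)) (sym (count-snoc g n))

count-rotate : ∀ g {n} c .{{_ : NonZero n}} → c ≤ n →
               count (λ j → g ((c + j) % n)) n ≡ count g n
count-rotate g {n} c c≤n = begin
  count g′ n                                         ≡⟨ cong (count g′) (m∸n+n≡m c≤n) ⟨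
  count g′ (n ∸ c + c)                               ≡⟨ count-+ g′ (n ∸ c) c ⟩
  count g′ (n ∸ c) + count (λ j → g′ (n ∸ c + j)) c  ≡⟨ cong₂ _+_ (count-cong (n ∸ c) unwrapped)
                                                                 (count-cong c wrapped) ⟩
  count (λ j → g (c + j)) (n ∸ c) + count g c        ≡⟨ +-comm _ (count g c) ⟩
  count g c + count (λ j → g (c + j)) (n ∸ c)        ≡⟨ count-+ g c (n ∸ c) ⟨
  count g (c + (n ∸ c))                              ≡⟨ cong (count g) (m+[n∸m]≡n c≤n) ⟩
  count g n                                          ∎
  where
  open ≡-Reasoning
  g′ : ℕ → Bool
  g′ j = g ((c + j) % n)
  unwrapped : ∀ {j} → j < n ∸ c → g′ j ≡ g (c + j)
  unwrapped j<n∸c =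
    cong g (m<n⇒m%n≡m (subst (_ <_) (m+[n∸m]≡n c≤n) (+-monoʳ-< c j<n∸c)))
  wrapped : ∀ {j} → j < c → g′ (n ∸ c + j) ≡ g j
  wrapped {j} j<c = cong g (begin
    (c + (n ∸ c + j)) % n  ≡⟨ cong (_% n) (trans (sym (+-assoc c (n ∸ c) j)) (cong (_+ j) (m+[n∸m]≡n c≤n))) ⟩
    (n + j) % n            ≡⟨ cong (_% n) (+-comm n j) ⟩
    (j + n) % n            ≡⟨ [m+n]%n≡m%n j n ⟩
    j % n                  ≡⟨ m<n⇒m%n≡m (<-≤-trans j<c c≤n) ⟩
    j                      ∎)

count-reflect : ∀ g {n} a .{{_ : NonZero n}} → a < n →
                count (λ j → g ((a + n ∸ j) % n)) n ≡ count g n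
count-reflect g {n} a a<n = begin
  count g′ n                            ≡⟨ count-reverse g′ n ⟨
  count (λ j → g′ (n ∸ suc j)) n        ≡⟨ count-cong n (cong (λ k → g (k % n)) ∘ reflect) ⟩
  count (λ j → g ((suc a + j) % n)) n   ≡⟨ count-rotate g (suc a) a<n ⟩
  count g n                             ∎
  where
  open ≡-Reasoning
  g′ : ℕ → Bool
  g′ j = g ((a + n ∸ j) % n)
  reflect : ∀ {j} → j < n → a + n ∸ (n ∸ suc j) ≡ suc a + j
  reflect {j} j<n = begin
    a + n ∸ (n ∸ suc j)    ≡⟨ +-∸-assoc a (m∸n≤m n (suc j)) ⟩
    a + (n ∸ (n ∸ suc j))  ≡⟨ cong (a +_) (m∸[m∸n]≡n j<n) ⟩
    a + suc j              ≡⟨ +-suc a j ⟩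
    suc a + j              ∎

count-<ᵇ : ∀ {q} n → q ≤ n → count (_<ᵇ q) n ≡ q
count-<ᵇ {zero}  zero    _         = refl
count-<ᵇ {zero}  (suc n) _         = count-<ᵇ n z≤n
count-<ᵇ {suc q} (suc n) (s≤s q≤n) = cong suc (count-<ᵇ n q≤n)

∣tabulate∣≡count : ∀ g n → ∣ tabulate {n = n} (g ∘ toℕ) ∣ ≡ count g n
∣tabulate∣≡count g zero    = refl
∣tabulate∣≡count g (suc n) with g 0
... | true  = cong suc (∣tabulate∣≡count (g ∘ suc) n)
... | false = ∣tabulate∣≡count (g ∘ suc) n

count[t*n+pred[n]<ᵇo]≡o/n : ∀ {o} n m .{{_ : NonZero n}} → o / n ≤ m →
                            count (λ t → t * n + pred n <ᵇ o) m ≡ o / n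
count[t*n+pred[n]<ᵇo]≡o/n {o} n m o/n≤m = trans
  (≤-antisym (count-mono m (λ {t} _ → <⇒<ᵇ ∘ to window ∘ <ᵇ⇒< (t * n + pred n) o))
             (count-mono m (λ {t} _ → <⇒<ᵇ ∘ from window ∘ <ᵇ⇒< t (o / n))))
  (count-<ᵇ m o/n≤m)
  where
  window : ∀ {t} → t * n + pred n < o ⇔ t < o / n
  window = m*n+pred[n]<o⇔m<o/n n

∈⇔T-lookup : ∀ {n} {p : Subset n} {i} → i ∈ p ⇔ T (lookup p i)
∈⇔T-lookup {p = p} {i} = mk⇔ (from T-≡ ∘ []=⇒lookup) (lookup⇒[]= i p ∘ to T-≡)

∈-tabulate : ∀ {n} {f : Fin n → Bool} {i} → i ∈ tabulate f ⇔ T (f i)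
∈-tabulate {f = f} {i} = subst (λ b → i ∈ tabulate f ⇔ T b) (lookup∘tabulate f i) ∈⇔T-lookup

least : ∀ {n} (p : Subset n) → Nonempty p → ∃ λ i → i ∈ p × (∀ {j} → j ∈ p → toℕ i ≤ toℕ j)
least (inside  ∷ p) _                 = Fin.zero , here , λ _ → z≤n
least (outside ∷ p) (Fin.zero  , ())
least (outside ∷ p) (Fin.suc i , i∈p) with least p (i , drop-there i∈p)
... | j , j∈p , j-least = Fin.suc j , there j∈p , λ { (there k∈p) → s≤s (j-least k∈p) }

incidentEdges : (H : Hypergraph) → Fin (nV H) → Subset (nE H)
incidentEdges H v = tabulate (λ e → lookup (edge H e) v)

∈-incidentEdges : ∀ H {v e} → e ∈ incidentEdges H v ⇔ v ∈ edge H e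
∈-incidentEdges H = ⇔-trans ∈-tabulate (⇔-sym ∈⇔T-lookup)

deg-⊤ : ∀ H v → deg H ⊤ v ≡ ∣ incidentEdges H v ∣
deg-⊤ H v = cong ∣_∣ (∩-identityˡ (incidentEdges H v))

deg-mono : ∀ H {F G} v → F ⊆ G → deg H F v ≤ deg H G v
deg-mono H {F} v F⊆G = p⊆q⇒∣p∣≤∣q∣ λ e∈F∩ →
  let e∈F , e∈inc = x∈p∩q⁻ F (incidentEdges H v) e∈F∩ in x∈p∩q⁺ (F⊆G e∈F , e∈inc)

deg-Empty : ∀ H {F} v → Empty F → deg H F v ≡ 0
deg-Empty H {F} v F-empty = n≤0⇒n≡0 (begin
  deg H F v     ≤⟨ ∣p∩q∣≤∣p∣ F (incidentEdges H v) ⟩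
  ∣ F ∣         ≡⟨ cong ∣_∣ (Empty-unique F-empty) ⟩
  ∣ ⊥ {nE H} ∣  ≡⟨ ∣⊥∣≡0 (nE H) ⟩
  0             ∎)
  where open ≤-Reasoning

deg-pos : ∀ H {F v} e → e ∈ F → v ∈ edge H e → 1 ≤ deg H F v
deg-pos H {F} {v} e e∈F v∈e = subst (_≤ deg H F v) (∣⁅x⁆∣≡1 e) (p⊆q⇒∣p∣≤∣q∣ ⁅e⁆⊆)
  where
  ⁅e⁆⊆ : ⁅ e ⁆ ⊆ F ∩ incidentEdges H v
  ⁅e⁆⊆ e′∈⁅e⁆ rewrite x∈⁅y⁆⇒x≡y e e′∈⁅e⁆ = x∈p∩q⁺ (e∈F , from (∈-incidentEdges H) v∈e)

deg≤1 : ∀ H {F} v i → (∀ {e} → e ∈ F → v ∈ edge H e → e ≡ i) → deg H F v ≤ 1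
deg≤1 H {F} v i unique = subst (deg H F v ≤_) (∣⁅x⁆∣≡1 i) (p⊆q⇒∣p∣≤∣q∣ ⊆⁅i⁆)
  where
  ⊆⁅i⁆ : F ∩ incidentEdges H v ⊆ ⁅ i ⁆
  ⊆⁅i⁆ e∈F∩ with x∈p∩q⁻ F (incidentEdges H v) e∈F∩
  ... | e∈F , e∈inc rewrite unique e∈F (to (∈-incidentEdges H) e∈inc) = x∈⁅x⁆ i

Degeneracy-intro : ∀ H k →
  (∀ v → k ≤ deg H ⊤ v) →
  (∃ λ v → deg H ⊤ v ≡ k) →
  (∀ F → Nonempty F → ∃₂ λ e v → e ∈ F × v ∈ edge H e × deg H F v ≤ k) →
  Degeneracy H k
Degeneracy-intro H k k≤deg (v₀ , deg≡k) sparse =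
  (⊤ , ⊤ , (λ _ _ → ⊆⊤) , (λ v _ → k≤deg v) , v₀ , ∈⊤ , deg≡k) , bounded
  where
  bounded : ∀ U F j → IsSub H U F → MinDeg H U F j → j ≤ k
  bounded U F j F⊆U (j≤deg , w , w∈U , _) with nonempty? F
  ... | no  F-empty = ≤-trans (j≤deg w w∈U) (subst (_≤ k) (sym (deg-Empty H w F-empty)) z≤n)
  ... | yes F≠∅     = let e , v , e∈F , v∈e , deg≤k = sparse F F≠∅ in
                      ≤-trans (j≤deg v (F⊆U e e∈F v∈e)) deg≤k

module _ {s ℓ : ℕ} (ℓ<s : ℓ < s) where
  private
    d : ℕ
    d = s ∸ ℓ
    instance
      d-nonZero : NonZero d
      d-nonZero = >-nonZero (m<n⇒0<n∸m ℓ<s)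
    d≤s : d ≤ s
    d≤s = m∸n≤m s ℓ

  Path-∈ : ∀ {m} (i : Fin m) {v : Fin (nV (Path s ℓ m))} →
           v ∈ edge (Path s ℓ m) i ⇔ (toℕ i * d ≤ toℕ v × toℕ v < toℕ i * d + s)
  Path-∈ i {v} = mk⇔
    (λ v∈i → let i*d≤ᵇv , v<ᵇ = to T-∧ (to ∈-tabulate v∈i) in
             ≤ᵇ⇒≤ (toℕ i * d) (toℕ v) i*d≤ᵇv , <ᵇ⇒< (toℕ v) (toℕ i * d + s) v<ᵇ)
    (λ (i*d≤v , v<) → from ∈-tabulate (from T-∧ (≤⇒≤ᵇ i*d≤v , <⇒<ᵇ v<)))

  Path-covered : ∀ {m} (v : Fin (nV (Path s ℓ (suc m)))) → ∃ λ e → v ∈ edge (Path s ℓ (suc m)) e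
  Path-covered {m} v = e , from (Path-∈ e)
    (subst (λ b → b * d ≤ x × x < b * d + s) (sym (toℕ-fromℕ< a<1+m)) (a*d≤x , x<a*d+s))
    where
    x a : ℕ
    x = toℕ v
    a = x / d ⊓ m
    a<1+m : a < suc m
    a<1+m = s≤s (m⊓n≤n (x / d) m)
    e : Fin (suc m)
    e = fromℕ< a<1+m
    a*d≤x : a * d ≤ x
    a*d≤x = from (m*n≤o⇔m≤o/n d) (m⊓n≤m (x / d) m)
    x<a*d+s : x < a * d + s
    x<a*d+s with ⊓-sel (x / d) m
    ... | inj₁ a≡x/d = subst (λ b → x < b * d + s) (sym a≡x/d) (begin-strict
      x                  ≡⟨ m≡m%n+[m/n]*n x d ⟩
      x % d + x / d * d  <⟨ +-monoˡ-< (x / d * d) (m%n<n x d) ⟩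
      d + x / d * d      ≤⟨ +-monoˡ-≤ (x / d * d) d≤s ⟩
      s + x / d * d      ≡⟨ +-comm s (x / d * d) ⟩
      x / d * d + s      ∎)
      where open ≤-Reasoning
    ... | inj₂ a≡m = subst (λ b → x < b * d + s) (sym a≡m) (subst (x <_) nV≡ (toℕ<n v))
      where
      open ≡-Reasoning
      nV≡ : d * suc m + ℓ ≡ m * d + s
      nV≡ = begin
        d * suc m + ℓ    ≡⟨ cong (_+ ℓ) (trans (*-suc d m) (+-comm d (d * m))) ⟩
        d * m + d + ℓ    ≡⟨ +-assoc (d * m) d ℓ ⟩
        d * m + (d + ℓ)  ≡⟨ cong₂ _+_ (*-comm d m) (m∸n+n≡m (<⇒≤ ℓ<s)) ⟩
        m * d + s        ∎

  edgeStart : ∀ {m} → Fin m → Fin (nV (Path s ℓ m))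
  edgeStart {m} i = fromℕ< (begin-strict
    toℕ i * d  <⟨ *-monoˡ-< d (toℕ<n i) ⟩
    m * d      ≡⟨ *-comm m d ⟩
    d * m      ≤⟨ m≤m+n (d * m) ℓ ⟩
    d * m + ℓ  ∎)
    where open ≤-Reasoning

  edgeStart-∈ : ∀ {m} (i : Fin m) → edgeStart i ∈ edge (Path s ℓ m) i
  edgeStart-∈ i = from (Path-∈ i)
    (subst (λ x → toℕ i * d ≤ x × x < toℕ i * d + s) (sym (toℕ-fromℕ< _))
           (≤-refl , m<m+n (toℕ i * d) (≤-<-trans z≤n ℓ<s)))

  edgeStart-deg≤1 : ∀ {m} F (i : Fin m) → (∀ {e} → e ∈ F → toℕ i ≤ toℕ e) →
                    deg (Path s ℓ m) F (edgeStart i) ≤ 1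
  edgeStart-deg≤1 F i i-least = deg≤1 _ (edgeStart i) i λ {e} e∈F v∈e →
    toℕ-injective (≤-antisym
      (*-cancelʳ-≤ (toℕ e) (toℕ i) d (subst (toℕ e * d ≤_) (toℕ-fromℕ< _) (proj₁ (to (Path-∈ e) v∈e))))
      (i-least e∈F))

  Path-degeneracy : ∀ {m} → Degeneracy (Path s ℓ (suc m)) 1
  Path-degeneracy {m} = Degeneracy-intro (Path s ℓ (suc m)) 1 1≤deg
    (edgeStart Fin.zero , ≤-antisym (edgeStart-deg≤1 ⊤ Fin.zero (λ _ → z≤n)) (1≤deg _))
    λ F F≠∅ → let i , i∈F , i-least = least F F≠∅ in
              i , edgeStart i , i∈F , edgeStart-∈ i , edgeStart-deg≤1 F i i-least
    where
    1≤deg : ∀ v → 1 ≤ deg (Path s ℓ (suc m)) ⊤ v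
    1≤deg v = let e , v∈e = Path-covered v in deg-pos (Path s ℓ (suc m)) e ∈⊤ v∈e

  module _ {m : ℕ} .{{_ : NonZero m}} where
    private
      instance
        N-nonZero : NonZero (d * m)
        N-nonZero = m*n≢0 d m
      pred[d]<d : pred d < d
      pred[d]<d = m≤pred[n]⇒suc[m]≤n ≤-refl

    Cycle-∈ : ∀ j {v : Fin (d * m)} →
              v ∈ edge (Cycle s ℓ m) j ⇔ T ((toℕ v + d * m ∸ toℕ j * d) % (d * m) <ᵇ s)
    Cycle-∈ j {v} = subst (λ k → v ∈ edge (Cycle s ℓ m) j ⇔ T (k <ᵇ s)) (mod≡% _ (d * m)) ∈-tabulate

    Cycle-offset : ∀ x {j} → j ≤ m →
                   (x + d * m ∸ j * d) % (d * m) ≡ ((x / d + m ∸ j) % m) * d + x % d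
    Cycle-offset x {j} j≤m =
      trans (cong (_% (d * m)) unfold) ([m*n+o]%[n*p]≡[m%p]*n+o (x / d + m ∸ j) m (m%n<n x d))
      where
      open ≡-Reasoning
      a r : ℕ
      a = x / d
      r = x % d
      j*d≤ : j * d ≤ a * d + m * d
      j*d≤ = ≤-trans (*-monoˡ-≤ d j≤m) (m≤n+m (m * d) (a * d))
      unfold : x + d * m ∸ j * d ≡ (a + m ∸ j) * d + r
      unfold = begin
        x + d * m ∸ j * d            ≡⟨ cong (λ y → y + d * m ∸ j * d) (m≡m%n+[m/n]*n x d) ⟩
        r + a * d + d * m ∸ j * d    ≡⟨ cong (_∸ j * d) (trans (+-assoc r (a * d) (d * m))
                                                           (cong (λ k → r + (a * d + k)) (*-comm d m))) ⟩
        r + (a * d + m * d) ∸ j * d  ≡⟨ +-∸-assoc r j*d≤ ⟩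
        r + (a * d + m * d ∸ j * d)  ≡⟨ cong (λ k → r + (k ∸ j * d)) (*-distribʳ-+ d a m) ⟨
        r + ((a + m) * d ∸ j * d)    ≡⟨ cong (r +_) (*-distribʳ-∸ d (a + m) j) ⟨
        r + (a + m ∸ j) * d          ≡⟨ +-comm r _ ⟩
        (a + m ∸ j) * d + r          ∎

    Cycle-deg-⊤ : ∀ v → deg (Cycle s ℓ m) ⊤ v ≡ count (λ t → t * d + toℕ v % d <ᵇ s) m
    Cycle-deg-⊤ v = begin
      deg (Cycle s ℓ m) ⊤ v              ≡⟨ deg-⊤ (Cycle s ℓ m) v ⟩
      ∣ incidentEdges (Cycle s ℓ m) v ∣  ≡⟨ cong ∣_∣ (tabulate-cong offset) ⟩
      ∣ tabulate {n = m} (g′ ∘ toℕ) ∣    ≡⟨ ∣tabulate∣≡count g′ m ⟩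
      count g′ m                         ≡⟨ count-reflect g {m} (x / d) (m<n*o⇒m/o<n x<m*d) ⟩
      count g m                          ∎
      where
      open ≡-Reasoning
      x : ℕ
      x = toℕ v
      x<m*d : x < m * d
      x<m*d = subst (x <_) (*-comm d m) (toℕ<n v)
      g g′ : ℕ → Bool
      g t = t * d + x % d <ᵇ s
      g′ j = g ((x / d + m ∸ j) % m)
      offset : ∀ e → lookup (edge (Cycle s ℓ m) e) v ≡ g′ (toℕ e)
      offset e = trans (lookup∘tabulate _ v)
        (cong (_<ᵇ s) (trans (mod≡% _ (d * m)) (Cycle-offset x (<⇒≤ (toℕ<n e)))))

    s/d≤Cycle-deg-⊤ : s / d ≤ m → ∀ v → s / d ≤ deg (Cycle s ℓ m) ⊤ v
    s/d≤Cycle-deg-⊤ s/d≤m v = begin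
      s / d                                  ≡⟨ count[t*n+pred[n]<ᵇo]≡o/n d m s/d≤m ⟨
      count (λ t → t * d + pred d <ᵇ s) m    ≤⟨ count-mono m (λ {t} _ → <⇒<ᵇ ∘ lower t ∘ <ᵇ⇒< _ s) ⟩
      count (λ t → t * d + toℕ v % d <ᵇ s) m ≡⟨ Cycle-deg-⊤ v ⟨
      deg (Cycle s ℓ m) ⊤ v                  ∎
      where
      open ≤-Reasoning
      lower : ∀ t → t * d + pred d < s → t * d + toℕ v % d < s
      lower t = ≤-<-trans (+-monoʳ-≤ (t * d) (<⇒≤pred (m%n<n (toℕ v) d)))

    blockEnd : Fin m → Fin (d * m)
    blockEnd i = fromℕ< (begin-strict
      toℕ i * d + pred d    <⟨ ≤-reflexive (suc[m*n+pred[n]]≡suc[m]*n (toℕ i) d) ⟩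
      suc (toℕ i) * d       ≤⟨ *-monoˡ-≤ d (toℕ<n i) ⟩
      m * d                 ≡⟨ *-comm m d ⟩
      d * m                 ∎)
      where open ≤-Reasoning

    blockEnd-residue : ∀ i → toℕ (blockEnd i) % d ≡ pred d
    blockEnd-residue i = begin
      toℕ (blockEnd i) % d       ≡⟨ cong (_% d) (trans (toℕ-fromℕ< _) (+-comm _ (pred d))) ⟩
      (pred d + toℕ i * d) % d   ≡⟨ [m+kn]%n≡m%n (pred d) (toℕ i) d ⟩
      pred d % d                 ≡⟨ m<n⇒m%n≡m pred[d]<d ⟩
      pred d                     ∎
      where open ≡-Reasoning

    blockEnd-∈ : ∀ i → blockEnd i ∈ edge (Cycle s ℓ m) i
    blockEnd-∈ i = from (Cycle-∈ i) (<⇒<ᵇ (subst (_< s) (sym offset) (<-≤-trans pred[d]<d d≤s)))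
      where
      open ≡-Reasoning
      N i*d : ℕ
      N = d * m
      i*d = toℕ i * d
      offset : (toℕ (blockEnd i) + N ∸ i*d) % N ≡ pred d
      offset = begin
        (toℕ (blockEnd i) + N ∸ i*d) % N  ≡⟨ cong (λ y → (y + N ∸ i*d) % N) (toℕ-fromℕ< _) ⟩
        (i*d + pred d + N ∸ i*d) % N      ≡⟨ cong (λ y → (y ∸ i*d) % N) (+-assoc i*d (pred d) N) ⟩
        (i*d + (pred d + N) ∸ i*d) % N    ≡⟨ cong (_% N) (m+n∸m≡n i*d (pred d + N)) ⟩
        (pred d + N) % N                  ≡⟨ [m+n]%n≡m%n (pred d) N ⟩
        pred d % N                        ≡⟨ m<n⇒m%n≡m (<-≤-trans pred[d]<d (m≤m*n d m)) ⟩
        pred d                            ∎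

    blockEnd-deg-⊤ : s / d ≤ m → ∀ i → deg (Cycle s ℓ m) ⊤ (blockEnd i) ≡ s / d
    blockEnd-deg-⊤ s/d≤m i = begin
      deg (Cycle s ℓ m) ⊤ (blockEnd i)                   ≡⟨ Cycle-deg-⊤ (blockEnd i) ⟩
      count (λ t → t * d + toℕ (blockEnd i) % d <ᵇ s) m  ≡⟨ cong (λ r → count (λ t → t * d + r <ᵇ s) m)
                                                                (blockEnd-residue i) ⟩
      count (λ t → t * d + pred d <ᵇ s) m                ≡⟨ count[t*n+pred[n]<ᵇo]≡o/n d m s/d≤m ⟩
      s / d                                              ∎
      where open ≡-Reasoning

    Cycle-degeneracy : s / d ≤ m → Degeneracy (Cycle s ℓ m) (s / d)
    Cycle-degeneracy s/d≤m = Degeneracy-intro (Cycle s ℓ m) (s / d) (s/d≤Cycle-deg-⊤ s/d≤m)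
      (blockEnd i₀ , blockEnd-deg-⊤ s/d≤m i₀)
      λ F (i , i∈F) → i , blockEnd i , i∈F , blockEnd-∈ i ,
        ≤-trans (deg-mono (Cycle s ℓ m) {F} (blockEnd i) ⊆⊤) (≤-reflexive (blockEnd-deg-⊤ s/d≤m i))
      where
      i₀ : Fin m
      i₀ = fromℕ< (>-nonZero⁻¹ m)

claim4 : ∀ (s ℓ m : ℕ) → 1 ≤ ℓ → ℓ < s → 1 ≤ m →
    Degeneracy (Path s ℓ m) 1 ×
    (m ≥ (s + 1) ÷ (s ∸ ℓ) → Degeneracy (Cycle s ℓ m) (s ÷ (s ∸ ℓ)))
claim4 s ℓ zero    _ _   ()
claim4 s ℓ (suc m) _ ℓ<s _ = Path-degeneracy ℓ<s , λ [s+1]÷d≤m →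
  subst (Degeneracy (Cycle s ℓ (suc m))) (sym (÷≡/ s d))
    (Cycle-degeneracy ℓ<s (≤-trans (/-monoˡ-≤ d (m≤m+n s 1))
                                   (subst (_≤ suc m) (÷≡/ (s + 1) d) [s+1]÷d≤m)))
  where
  d : ℕ
  d = s ∸ ℓ
  instance
    d-nonZero : NonZero d
    d-nonZero = >-nonZero (m<n⇒0<n∸m ℓ<s)
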